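{- For all integers $r\geq 2$, $t\geq 3$ and $n\geq 1$, there exist an $(r,S_t)$-extremal graph $G$ on $n$ vertices and a constant $c(r,t)\leq rt+1$ (depending only on $r$ and $t$) such that $\Delta(G)\leq r(t-1)-1$, and $d(v)\geq \lceil r/2\rceil\cdot(t-1)$ holds for all but at most $c(r,t)$ vertices $v\in V(G)$.
   Context: For a positive integer $t$, $S_t$ denotes the star with $t$ edges (and $t+1$ vertices). For a positive integer $r$ and graphs $G,H$ (simple graphs), $c_{r,H}(G)$ is the number of $r$-edge-colorings of $G$ (functions $c:E(G)\to\{1,\dots,r\}$) with no monochromatic copy of $H$ as a subgraph, and $c_{r,H}(n)$ is the maximum of $c_{r,H}(G)$ over all graphs $G$ on $n$ vertices. A graph $G$ is $(r,H)$-extremal if $c_{r,H}(G)=c_{r,H}(|V(G)|)$. $\Delta(G)$ is the maximum degree and $d(v)$ the degree of $v$. -}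

module Defs where

open import Data.Nat using (ℕ; _≤_; _<_; _<?_)
open import Data.Fin using (Fin; toℕ; _≟_)
open import Data.Fin.Properties using ()
open import Data.List using (List; length; filter; lookup; allFin)
open import Data.List.Relation.Unary.All using (All)
open import Data.List.Relation.Unary.Unique.Propositional using (Unique)
open import Data.List.Membership.Propositional using (_∈_)
open import Data.Vec using (Vec)
import Data.Vec as V
open import Data.Product using (Σ; _×_; _,_; proj₁; proj₂; ∃)
open import Data.Sum using (_⊎_)
open import Function.Definitions using (Injective)
open import Function.Bundles using (_⇔_)
open import Relation.Binary.PropositionalEquality using (_≡_)
open import Relation.Nullary using (¬_)
open import Relation.Nullary.Decidable using (_⊎-dec_)

-- A simple graph on vertex set Fin n, given by its list of edges.
-- Each edge {i,j} is stored once, as the pair (i , j) with i < j;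
-- the list has no repetitions.
record Graph (n : ℕ) : Set where
  field
    edges   : List (Fin n × Fin n)
    ordered : All (λ e → toℕ (proj₁ e) < toℕ (proj₂ e)) edges
    nodup   : Unique edges
open Graph public

e : ∀ {n} → Graph n → ℕ
e G = length (edges G)

-- an r-edge-colouring: one colour for each edge (indexed by position in the edge list)
Colouring : ∀ {n} → ℕ → Graph n → Set
Colouring r G = Vec (Fin r) (e G)

Joins : ∀ {n} (G : Graph n) → Fin (e G) → Fin n → Fin n → Set
Joins G p u w = (lookup (edges G) p ≡ (u , w)) ⊎ (lookup (edges G) p ≡ (w , u))

HasMonoStar : ∀ {n} (r t : ℕ) (G : Graph n) → Colouring r G → Set
HasMonoStar {n} r t G κ =
  Σ (Fin n) λ v → Σ (Fin t → Fin n) λ f → Injective _≡_ _≡_ f × Σ (Fin r) λ col →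
    ∀ i → Σ (Fin (e G)) λ p → Joins G p v (f i) × V.lookup κ p ≡ col

NumGood : ∀ {n} (r t : ℕ) (G : Graph n) → ℕ → Set
NumGood r t G k =
  Σ (List (Colouring r G)) λ L →
    (length L ≡ k) × Unique L × (∀ κ → (κ ∈ L) ⇔ (¬ HasMonoStar r t G κ))

Extremal : ∀ {n} (r t : ℕ) → Graph n → Set
Extremal {n} r t G =
  Σ ℕ λ k → NumGood r t G k × (∀ (G' : Graph n) (k' : ℕ) → NumGood r t G' k' → k' ≤ k)

degree : ∀ {n} → Graph n → Fin n → ℕ
degree G v = length (filter (λ x → (v ≟ proj₁ x) ⊎-dec (v ≟ proj₂ x)) (edges G))

numBelow : ∀ {n} → Graph n → ℕ → ℕ
numBelow {n} G b = length (filter (λ v → degree G v <? b) (allFin n))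

module Submission where

-- Write B = t − 1: a colouring has no monochromatic S_t iff every vertex has at most B
-- edges of each colour. Among all graphs on n vertices take one maximising, lexicographically,
-- the number of such colourings, then whether all degrees are below rB, then the number of
-- edges. Deleting an edge at a vertex of degree at least rB loses no colouring: all r colour
-- classes there are full, so the colour of the deleted edge is forced. Hence the maximiser has
-- maximum degree at most rB − 1. Adding an edge between two vertices of degree below ⌈r/2⌉B
-- loses no colouring either: each endpoint has fewer than ⌈r/2⌉ full colours, so some colour is
-- free at both. Hence in the maximiser these light vertices are pairwise adjacent, so there are
-- at most ⌈r/2⌉B ≤ rt + 1 of them.

open import Defs
open import Data.Bool using (Bool; true; false; _∧_; if_then_else_)
open import Data.Fin using (Fin; zero; suc; inject≤; toℕ; _≟_)
import Data.Fin.Properties as Fin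
open import Data.List
  using (List; []; _∷_; length; lookup; filter; removeAt; map; concatMap; allFin; deduplicate; cartesianProduct)
open import Data.List.Extrema.Nat using (argmax; f[xs]≤f[argmax])
open import Data.List.Membership.Propositional using (_∈_; lose)
open import Data.List.Membership.Propositional.Properties
  using (∈-lookup; ∈-allFin; ∈-cartesianProduct⁺; ∈-map⁺; ∈-concatMap⁺; ∈-filter⁺; ∈-filter⁻; deduplicate-∈⇔)
open import Data.List.Properties using (length-removeAt′)
open import Data.List.Relation.Unary.All as All using (All; []; _∷_)
open import Data.List.Relation.Unary.All.Properties using (¬Any⇒All¬)
open import Data.List.Relation.Unary.AllPairs using ([]; _∷_)
open import Data.List.Relation.Unary.Any using (index; here; there)
open import Data.List.Relation.Unary.Any.Properties using (lookup-index)
open import Data.List.Relation.Unary.Unique.Propositional using (Unique)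
open import Data.List.Relation.Unary.Unique.Propositional.Properties using (filter⁺; allFin⁺)
import Data.List.Relation.Unary.Unique.DecPropositional as Unique
open import Data.List.Relation.Unary.Unique.DecPropositional.Properties using (deduplicate-!)
open import Data.Nat
  using (ℕ; zero; suc; _+_; _*_; _∸_; _≤_; _<_; z≤n; s≤s; s≤s⁻¹; _<?_; _≤?_; ⌈_/2⌉; >-nonZero)
open import Data.Nat.Properties hiding (_≟_)
open import Algebra.Properties.CommutativeSemigroup +-commutativeSemigroup using (x∙yz≈y∙xz)
open import Algebra.Properties.Semiring.Sum +-*-semiring
  using (sum; sum-syntax; sum-cong-≗; ∑-comm; ∑-distrib-+; *-distribˡ-sum)
open import Data.Product using (Σ; _×_; _,_; proj₁; proj₂)
open import Data.Product.Properties using (≡-dec)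
open import Data.Sum using (_⊎_; inj₁; inj₂)
open import Data.Vec using (Vec; []; _∷_)
import Data.Vec as Vec
import Data.Vec.Properties as Vec
open import Function using (_∘_; id)
open import Function.Bundles using (Equivalence; mk⇔)
open import Function.Definitions using (Injective)
open import Level using (0ℓ)
open import Relation.Binary.Definitions using (DecidableEquality; Tri; tri<; tri≈; tri>)
open import Relation.Binary.PropositionalEquality
open import Relation.Nullary using (¬_; contradiction; does; yes; no; Dec)
open import Relation.Nullary.Decidable using (_⊎-dec_; _×-dec_; dec-true; dec-false; decidable-stable)
open import Relation.Unary using (Pred; Decidable)

-- Finite sums and counting

bit : Bool → ℕ
bit true  = 1
bit false = 0

bit-∧ : ∀ a b → bit (a ∧ b) ≡ bit a * bit b
bit-∧ true  b = sym (+-identityʳ (bit b))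
bit-∧ false b = refl

⌈n/2⌉+⌈n/2⌉≤1+n : ∀ m → ⌈ m /2⌉ + ⌈ m /2⌉ ≤ suc m
⌈n/2⌉+⌈n/2⌉≤1+n zero          = z≤n
⌈n/2⌉+⌈n/2⌉≤1+n (suc zero)    = s≤s (s≤s z≤n)
⌈n/2⌉+⌈n/2⌉≤1+n (suc (suc m)) =
  s≤s (subst (_≤ suc (suc m)) (sym (+-suc ⌈ m /2⌉ ⌈ m /2⌉)) (s≤s (⌈n/2⌉+⌈n/2⌉≤1+n m)))

*+-<-leading : ∀ {M c₁ c₂ b₁} b₂ → b₁ < M → c₁ < c₂ → c₁ * M + b₁ < c₂ * M + b₂
*+-<-leading {M} {c₁} {c₂} {b₁} b₂ b₁<M c₁<c₂ = begin-strict
  c₁ * M + b₁ <⟨ +-monoʳ-< (c₁ * M) b₁<M ⟩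
  c₁ * M + M  ≡⟨ +-comm (c₁ * M) M ⟩
  suc c₁ * M  ≤⟨ *-monoˡ-≤ M c₁<c₂ ⟩
  c₂ * M      ≤⟨ m≤m+n (c₂ * M) b₂ ⟩
  c₂ * M + b₂ ∎
  where open ≤-Reasoning

*+-<-trailing : ∀ M {c₁ c₂ b₁ b₂} → c₁ ≤ c₂ → b₁ < b₂ → c₁ * M + b₁ < c₂ * M + b₂
*+-<-trailing M c₁≤c₂ b₁<b₂ = +-mono-≤-< (*-monoˡ-≤ M c₁≤c₂) b₁<b₂

∑-mono-≤ : ∀ {k} {f g : Fin k → ℕ} → (∀ c → f c ≤ g c) → sum f ≤ sum g
∑-mono-≤ {zero}  f≤g = z≤n
∑-mono-≤ {suc k} f≤g = +-mono-≤ (f≤g zero) (∑-mono-≤ (f≤g ∘ suc))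

∑-const : ∀ k B → ∑[ c < k ] B ≡ k * B
∑-const zero    B = refl
∑-const (suc k) B = cong (B +_) (∑-const k B)

∑-zero : ∀ k → ∑[ c < k ] 0 ≡ 0
∑-zero k = trans (∑-const k 0) (*-zeroʳ k)

∑-<-const : ∀ {k B} {f : Fin k → ℕ} → (∀ c → f c ≤ B) → ∀ c → f c < B → sum f < k * B
∑-<-const {suc k} {B} {f} f≤B zero fc<B = begin-strict
  f zero + sum (f ∘ suc) <⟨ +-mono-<-≤ fc<B (∑-mono-≤ (f≤B ∘ suc)) ⟩
  B + ∑[ c < k ] B       ≡⟨ cong (B +_) (∑-const k B) ⟩
  B + k * B              ∎
  where open ≤-Reasoning
∑-<-const {suc k} f≤B (suc c) fc<B = +-mono-≤-< (f≤B zero) (∑-<-const (f≤B ∘ suc) c fc<B)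

∑-saturated : ∀ {k B} {f : Fin k → ℕ} → (∀ c → f c ≤ B) → k * B ≤ sum f → ∀ c → f c ≡ B
∑-saturated f≤B kB≤∑ c with m≤n⇒m<n∨m≡n (f≤B c)
... | inj₁ fc<B = contradiction kB≤∑ (<⇒≱ (∑-<-const f≤B c fc<B))
... | inj₂ fc≡B = fc≡B

∑-bit-≟ : ∀ {r} (k : Fin r) → ∑[ c < r ] bit (does (k ≟ c)) ≡ 1
∑-bit-≟ {suc r} zero    = cong suc (∑-zero r)
∑-bit-≟ {suc r} (suc k) = ∑-bit-≟ k

∑-bit-∧-≟ : ∀ {r} a (k : Fin r) → ∑[ c < r ] bit (a ∧ does (k ≟ c)) ≡ bit a
∑-bit-∧-≟ {r} a k = begin
  ∑[ c < r ] bit (a ∧ does (k ≟ c))       ≡⟨ sum-cong-≗ (λ c → bit-∧ a (does (k ≟ c))) ⟩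
  ∑[ c < r ] (bit a * bit (does (k ≟ c))) ≡⟨ *-distribˡ-sum (bit a) (λ c → bit (does (k ≟ c))) ⟨
  bit a * ∑[ c < r ] bit (does (k ≟ c))   ≡⟨ cong (bit a *_) (∑-bit-≟ k) ⟩
  bit a * 1                               ≡⟨ *-identityʳ (bit a) ⟩
  bit a                                   ∎
  where open ≡-Reasoning

count : ∀ {m} {P : Pred (Fin m) 0ℓ} → Decidable P → ℕ
count P? = ∑[ p < _ ] bit (does (P? p))

select : ∀ {m} {P : Pred (Fin m) 0ℓ} (P? : Decidable P) → Fin (count P?) → Fin m
select {suc m} P? k with P? zero
select {suc m} P? zero    | yes _ = zero
select {suc m} P? (suc k) | yes _ = suc (select (P? ∘ suc) k)
select {suc m} P? k       | no _  = suc (select (P? ∘ suc) k)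

select-sound : ∀ {m} {P : Pred (Fin m) 0ℓ} (P? : Decidable P) (k : Fin (count P?)) → P (select P? k)
select-sound {suc m} P? k with P? zero
select-sound {suc m} P? zero    | yes p₀ = p₀
select-sound {suc m} P? (suc k) | yes _  = select-sound (P? ∘ suc) k
select-sound {suc m} P? k       | no _   = select-sound (P? ∘ suc) k

select-injective : ∀ {m} {P : Pred (Fin m) 0ℓ} (P? : Decidable P) → Injective _≡_ _≡_ (select P?)
select-injective {suc m} P? {k} {l} eq with P? zero
select-injective {suc m} P? {zero}  {zero}  eq | yes _ = refl
select-injective {suc m} P? {suc k} {suc l} eq | yes _ = cong suc (select-injective (P? ∘ suc) (Fin.suc-injective eq))
select-injective {suc m} P? {k}     {l}     eq | no _  = select-injective (P? ∘ suc) (Fin.suc-injective eq)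

rank : ∀ {m} {P : Pred (Fin m) 0ℓ} (P? : Decidable P) (p : Fin m) → P p → Fin (count P?)
rank {suc m} P? zero with P? zero
... | yes _  = λ _ → zero
... | no ¬p₀ = λ p₀ → contradiction p₀ ¬p₀
rank {suc m} P? (suc p) with P? zero
... | yes _ = suc ∘ rank (P? ∘ suc) p
... | no _  = rank (P? ∘ suc) p

select-rank : ∀ {m} {P : Pred (Fin m) 0ℓ} (P? : Decidable P) (p : Fin m) (Pp : P p) → select P? (rank P? p Pp) ≡ p
select-rank {suc m} P? zero with P? zero
... | yes _  = λ _ → refl
... | no ¬p₀ = λ p₀ → contradiction p₀ ¬p₀
select-rank {suc m} P? (suc p) with P? zero
... | yes _ = cong suc ∘ select-rank (P? ∘ suc) p
... | no _  = cong suc ∘ select-rank (P? ∘ suc) p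

injection⇒≤count : ∀ {a m} {P : Pred (Fin m) 0ℓ} (P? : Decidable P) (g : Fin a → Fin m) →
                   Injective _≡_ _≡_ g → (∀ i → P (g i)) → a ≤ count P?
injection⇒≤count P? g g-injective Pg = Fin.injective⇒≤ rank∘g-injective
  where
  rank∘g-injective : Injective _≡_ _≡_ (λ i → rank P? (g i) (Pg i))
  rank∘g-injective {i} {j} eq = g-injective (begin
    g i                              ≡⟨ select-rank P? (g i) (Pg i) ⟨
    select P? (rank P? (g i) (Pg i)) ≡⟨ cong (select P?) eq ⟩
    select P? (rank P? (g j) (Pg j)) ≡⟨ select-rank P? (g j) (Pg j) ⟩
    g j                              ∎)
    where open ≡-Reasoning

≤count⇒injection : ∀ {a m} {P : Pred (Fin m) 0ℓ} (P? : Decidable P) → a ≤ count P? →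
                   Σ (Fin a → Fin m) λ g → Injective _≡_ _≡_ g × (∀ i → P (g i))
≤count⇒injection P? a≤ =
  (λ i → select P? (inject≤ i a≤)) ,
  (λ eq → Fin.inject≤-injective a≤ a≤ _ _ (select-injective P? eq)) ,
  (λ i → select-sound P? (inject≤ i a≤))

lookup-injective : ∀ {A : Set} {xs : List A} → Unique xs → Injective _≡_ _≡_ (lookup xs)
lookup-injective (x∉xs ∷ u) {zero}  {zero}  eq = refl
lookup-injective (x∉xs ∷ u) {zero}  {suc j} eq = contradiction eq (All.lookup x∉xs (∈-lookup j))
lookup-injective (x∉xs ∷ u) {suc i} {zero}  eq = contradiction (sym eq) (All.lookup x∉xs (∈-lookup i))
lookup-injective (x∉xs ∷ u) {suc i} {suc j} eq = cong suc (lookup-injective u eq)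

length-≤-of-injection : ∀ {A B : Set} {xs : List A} {ys : List B} → Unique xs → (h : A → B) →
  (∀ {x y} → x ∈ xs → y ∈ xs → h x ≡ h y → x ≡ y) → (∀ {x} → x ∈ xs → h x ∈ ys) →
  length xs ≤ length ys
length-≤-of-injection {xs = xs} {ys} unique h h-injective h∈ = Fin.injective⇒≤ position-injective
  where
  position : Fin (length xs) → Fin (length ys)
  position i = index (h∈ (∈-lookup i))
  position-injective : Injective _≡_ _≡_ position
  position-injective {i} {j} eq = lookup-injective unique (h-injective (∈-lookup i) (∈-lookup j) (begin
    h (lookup xs i)        ≡⟨ lookup-index (h∈ (∈-lookup i)) ⟩
    lookup ys (position i) ≡⟨ cong (lookup ys) eq ⟩
    lookup ys (position j) ≡⟨ lookup-index (h∈ (∈-lookup j)) ⟨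
    h (lookup xs j)        ∎))
    where open ≡-Reasoning

allVecs : ∀ r m → List (Vec (Fin r) m)
allVecs r zero    = [] ∷ []
allVecs r (suc m) = concatMap (λ c → map (c ∷_) (allVecs r m)) (allFin r)

∈-allVecs : ∀ {r m} (κ : Vec (Fin r) m) → κ ∈ allVecs r m
∈-allVecs []      = here refl
∈-allVecs (c ∷ κ) = ∈-concatMap⁺ (λ c → map (c ∷_) (allVecs _ _)) (lose (∈-allFin c) (∈-map⁺ (c ∷_) (∈-allVecs κ)))

All-removeAt : ∀ {A : Set} {P : A → Set} {xs : List A} (p : Fin (length xs)) → All P xs → All P (removeAt xs p)
All-removeAt zero    (_ ∷ pxs)  = pxs
All-removeAt (suc p) (px ∷ pxs) = px ∷ All-removeAt p pxs

Unique-removeAt : ∀ {A : Set} {xs : List A} (p : Fin (length xs)) → Unique xs → Unique (removeAt xs p)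
Unique-removeAt zero    (_ ∷ u)   = u
Unique-removeAt (suc p) (x∉ ∷ u) = All-removeAt p x∉ ∷ Unique-removeAt p u

removeAtᵛ : ∀ {A B : Set} (xs : List A) (p : Fin (length xs)) → Vec B (length xs) → Vec B (length (removeAt xs p))
removeAtᵛ (x ∷ xs) zero    (k ∷ κ) = κ
removeAtᵛ (x ∷ xs) (suc p) (k ∷ κ) = k ∷ removeAtᵛ xs p κ

removeAtᵛ-injective : ∀ {A B : Set} (xs : List A) (p : Fin (length xs)) {κ₁ κ₂ : Vec B (length xs)} →
  removeAtᵛ xs p κ₁ ≡ removeAtᵛ xs p κ₂ → Vec.lookup κ₁ p ≡ Vec.lookup κ₂ p → κ₁ ≡ κ₂
removeAtᵛ-injective (x ∷ xs) zero    {k ∷ κ₁} {k′ ∷ κ₂} eq eqₚ = cong₂ _∷_ eqₚ eq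
removeAtᵛ-injective (x ∷ xs) (suc p) {k ∷ κ₁} {k′ ∷ κ₂} eq eqₚ with Vec.∷-injective eq
... | k≡k′ , eq′ = cong₂ _∷_ k≡k′ (removeAtᵛ-injective xs p eq′ eqₚ)

count-removeAt : ∀ {A B : Set} {P : A → B → Set} (P? : ∀ x k → Dec (P x k))
  (xs : List A) (p : Fin (length xs)) (κ : Vec B (length xs)) →
  count (λ q → P? (lookup xs q) (Vec.lookup κ q))
    ≡ bit (does (P? (lookup xs p) (Vec.lookup κ p)))
      + count (λ q → P? (lookup (removeAt xs p) q) (Vec.lookup (removeAtᵛ xs p κ) q))
count-removeAt P? (x ∷ xs) zero    (k ∷ κ) = refl
count-removeAt P? (x ∷ xs) (suc p) (k ∷ κ) =
  trans (cong (bit (does (P? x k)) +_) (count-removeAt P? xs p κ))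
        (x∙yz≈y∙xz (bit (does (P? x k))) (bit (does (P? (lookup xs p) (Vec.lookup κ p)))) _)

-- Edges and colour degrees

Edge : ℕ → Set
Edge n = Fin n × Fin n

module _ {n : ℕ} where

  Incident : Fin n → Edge n → Set
  Incident w e = w ≡ proj₁ e ⊎ w ≡ proj₂ e

  incident? : ∀ w e → Dec (Incident w e)
  incident? w e = (w ≟ proj₁ e) ⊎-dec (w ≟ proj₂ e)

  Links : Edge n → Fin n → Fin n → Set
  Links e v a = e ≡ (v , a) ⊎ e ≡ (a , v)

  other : Fin n → Edge n → Fin n
  other v (a , b) = if does (v ≟ a) then b else a

  other-links : ∀ {e v a} → Links e v a → other v e ≡ a
  other-links {v = v} (inj₁ refl) rewrite dec-true (v ≟ v) refl = refl
  other-links {v = v} {a} (inj₂ refl) with v ≟ a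
  ... | yes v≡a = v≡a
  ... | no _    = refl

  links-other : ∀ {e v} → Incident v e → Links e v (other v e)
  links-other {a , b} {v} v∈e with v ≟ a | v∈e
  ... | yes refl | _         = inj₁ refl
  ... | no v≢a   | inj₁ v≡a  = contradiction v≡a v≢a
  ... | no _     | inj₂ refl = inj₂ refl

  links-incident : ∀ {e v a} → Links e v a → Incident v e
  links-incident (inj₁ refl) = inj₁ refl
  links-incident (inj₂ refl) = inj₂ refl

  ordered-links-unique : ∀ {e e′ v a} → toℕ (proj₁ e) < toℕ (proj₂ e) → toℕ (proj₁ e′) < toℕ (proj₂ e′) →
                         Links e v a → Links e′ v a → e ≡ e′
  ordered-links-unique _ _  (inj₁ refl) (inj₁ refl) = refl
  ordered-links-unique o o′ (inj₁ refl) (inj₂ refl) = contradiction o (<-asym o′)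
  ordered-links-unique o o′ (inj₂ refl) (inj₁ refl) = contradiction o (<-asym o′)
  ordered-links-unique _ _  (inj₂ refl) (inj₂ refl) = refl

  degreeIn : List (Edge n) → Fin n → ℕ
  degreeIn xs w = count (incident? w ∘ lookup xs)

  degree≡degreeIn : (G : Graph n) (w : Fin n) → degree G w ≡ degreeIn (edges G) w
  degree≡degreeIn G w = go (edges G)
    where
    go : (xs : List (Edge n)) → length (filter (incident? w) xs) ≡ degreeIn xs w
    go []       = refl
    go (x ∷ xs) with does (incident? w x)
    ... | true  = cong suc (go xs)
    ... | false = go xs

  colouredAt? : ∀ {r} (xs : List (Edge n)) (κ : Vec (Fin r) (length xs)) (w : Fin n) (c : Fin r)
                (p : Fin (length xs)) → Dec (Incident w (lookup xs p) × Vec.lookup κ p ≡ c)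
  colouredAt? xs κ w c p = incident? w (lookup xs p) ×-dec (Vec.lookup κ p ≟ c)

  colourDegree : ∀ {r} (xs : List (Edge n)) → Vec (Fin r) (length xs) → Fin n → Fin r → ℕ
  colourDegree xs κ w c = count (colouredAt? xs κ w c)

  colourDegree-removeAt : ∀ {r} (xs : List (Edge n)) (p : Fin (length xs)) (κ : Vec (Fin r) (length xs)) w c →
    colourDegree xs κ w c
      ≡ bit (does (colouredAt? xs κ w c p)) + colourDegree (removeAt xs p) (removeAtᵛ xs p κ) w c
  colourDegree-removeAt xs p κ w c = count-removeAt (λ x k → incident? w x ×-dec (k ≟ c)) xs p κ

  ∑-colourDegree : ∀ {r} (xs : List (Edge n)) (κ : Vec (Fin r) (length xs)) (w : Fin n) →
                   ∑[ c < r ] colourDegree xs κ w c ≡ degreeIn xs w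
  ∑-colourDegree {r} xs κ w =
    trans (∑-comm F) (sum-cong-≗ λ p → ∑-bit-∧-≟ (does (incident? w (lookup xs p))) (Vec.lookup κ p))
    where
    F : Fin r → Fin (length xs) → ℕ
    F c p = bit (does (incident? w (lookup xs p)) ∧ does (Vec.lookup κ p ≟ c))

-- Monochromatic stars and proper colourings

module _ {n r : ℕ} (t : ℕ) (G : Graph n) (κ : Colouring r G) where

  monoStar⇒t≤colourDegree : HasMonoStar r t G κ → Σ (Fin n) λ v → Σ (Fin r) λ c → t ≤ colourDegree (edges G) κ v c
  monoStar⇒t≤colourDegree (v , f , f-injective , c , star) =
    v , c , injection⇒≤count (colouredAt? (edges G) κ v c) g g-injective g-coloured
    where
    g : Fin t → Fin (e G)
    g i = proj₁ (star i)
    links : ∀ i → Links (lookup (edges G) (g i)) v (f i)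
    links i = proj₁ (proj₂ (star i))
    g-injective : Injective _≡_ _≡_ g
    g-injective {i} {j} eq = f-injective (begin
      f i                              ≡⟨ other-links (links i) ⟨
      other v (lookup (edges G) (g i)) ≡⟨ cong (other v ∘ lookup (edges G)) eq ⟩
      other v (lookup (edges G) (g j)) ≡⟨ other-links (links j) ⟩
      f j                              ∎)
      where open ≡-Reasoning
    g-coloured : ∀ i → Incident v (lookup (edges G) (g i)) × Vec.lookup κ (g i) ≡ c
    g-coloured i = links-incident (links i) , proj₂ (proj₂ (star i))

  t≤colourDegree⇒monoStar : ∀ v c → t ≤ colourDegree (edges G) κ v c → HasMonoStar r t G κ
  t≤colourDegree⇒monoStar v c t≤ = v , f , f-injective , c , λ i → g i , links i , proj₂ (g-coloured i)
    where
    chosen = ≤count⇒injection (colouredAt? (edges G) κ v c) t≤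
    g : Fin t → Fin (e G)
    g = proj₁ chosen
    g-coloured : ∀ i → Incident v (lookup (edges G) (g i)) × Vec.lookup κ (g i) ≡ c
    g-coloured = proj₂ (proj₂ chosen)
    f : Fin t → Fin n
    f i = other v (lookup (edges G) (g i))
    links : ∀ i → Links (lookup (edges G) (g i)) v (f i)
    links i = links-other (proj₁ (g-coloured i))
    ordered-at : ∀ i → toℕ (proj₁ (lookup (edges G) (g i))) < toℕ (proj₂ (lookup (edges G) (g i)))
    ordered-at i = All.lookup (ordered G) (∈-lookup (g i))
    f-injective : Injective _≡_ _≡_ f
    f-injective {i} {j} eq = proj₁ (proj₂ chosen) (lookup-injective (nodup G)
      (ordered-links-unique (ordered-at i) (ordered-at j) (links i)
        (subst (Links (lookup (edges G) (g j)) v) (sym eq) (links j))))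

module _ (r t : ℕ) {n : ℕ} where

  Proper : (xs : List (Edge n)) → Vec (Fin r) (length xs) → Set
  Proper xs κ = ∀ w c → colourDegree xs κ w c < t

  proper? : (xs : List (Edge n)) → Decidable (Proper xs)
  proper? xs κ = Fin.all? λ w → Fin.all? λ c → colourDegree xs κ w c <? t

  proper⇒¬monoStar : (G : Graph n) (κ : Colouring r G) → Proper (edges G) κ → ¬ HasMonoStar r t G κ
  proper⇒¬monoStar G κ proper star with monoStar⇒t≤colourDegree t G κ star
  ... | v , c , t≤ = <⇒≱ (proper v c) t≤

  ¬monoStar⇒proper : (G : Graph n) (κ : Colouring r G) → ¬ HasMonoStar r t G κ → Proper (edges G) κ
  ¬monoStar⇒proper G κ ¬star w c = ≰⇒> (¬star ∘ t≤colourDegree⇒monoStar t G κ w c)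

  properColourings : (xs : List (Edge n)) → List (Vec (Fin r) (length xs))
  properColourings xs = deduplicate (Vec.≡-dec _≟_) (filter (proper? xs) (allVecs r (length xs)))

  ∈-properColourings⁺ : ∀ xs {κ} → Proper xs κ → κ ∈ properColourings xs
  ∈-properColourings⁺ xs {κ} proper =
    Equivalence.to (deduplicate-∈⇔ (Vec.≡-dec _≟_)) (∈-filter⁺ (proper? xs) (∈-allVecs κ) proper)

  ∈-properColourings⁻ : ∀ xs {κ} → κ ∈ properColourings xs → Proper xs κ
  ∈-properColourings⁻ xs κ∈ = proj₂ (∈-filter⁻ (proper? xs) {xs = allVecs r (length xs)}
    (Equivalence.from (deduplicate-∈⇔ (Vec.≡-dec _≟_) {xs = filter (proper? xs) (allVecs r (length xs))}) κ∈))

  properColourings-unique : ∀ xs → Unique (properColourings xs)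
  properColourings-unique xs = deduplicate-! (Vec.≡-dec _≟_) _

  properCount : List (Edge n) → ℕ
  properCount xs = length (properColourings xs)

  properCount-mono : ∀ xs ys (h : Vec (Fin r) (length xs) → Vec (Fin r) (length ys)) →
    (∀ κ → Proper xs κ → Proper ys (h κ)) →
    (∀ {κ₁ κ₂} → Proper xs κ₁ → Proper xs κ₂ → h κ₁ ≡ h κ₂ → κ₁ ≡ κ₂) →
    properCount xs ≤ properCount ys
  properCount-mono xs ys h h-proper h-injective = length-≤-of-injection (properColourings-unique xs) h
    (λ κ₁∈ κ₂∈ → h-injective (∈-properColourings⁻ xs κ₁∈) (∈-properColourings⁻ xs κ₂∈))
    (λ κ∈ → ∈-properColourings⁺ ys (h-proper _ (∈-properColourings⁻ xs κ∈)))

  numGood-properCount : (G : Graph n) → NumGood r t G (properCount (edges G))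
  numGood-properCount G = properColourings (edges G) , refl , properColourings-unique (edges G) , λ κ →
    mk⇔ (proper⇒¬monoStar G κ ∘ ∈-properColourings⁻ (edges G)) (∈-properColourings⁺ (edges G) ∘ ¬monoStar⇒proper G κ)

  numGood⇒≤properCount : (G : Graph n) {k : ℕ} → NumGood r t G k → k ≤ properCount (edges G)
  numGood⇒≤properCount G (L , refl , L-unique , L⇔) = length-≤-of-injection L-unique id (λ _ _ → id)
    (λ {κ} κ∈ → ∈-properColourings⁺ (edges G) (¬monoStar⇒proper G κ (Equivalence.to (L⇔ κ) κ∈)))

-- Enumerating graphs; cliques of light vertices

module _ {n : ℕ} where

  _≟ᴱ_ : DecidableEquality (Edge n)
  _≟ᴱ_ = ≡-dec _≟_ _≟_

  open import Data.List.Membership.DecPropositional _≟ᴱ_ using (_∈?_) public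

  allEdges : List (Edge n)
  allEdges = cartesianProduct (allFin n) (allFin n)

  ∈-allEdges : ∀ (x : Edge n) → x ∈ allEdges
  ∈-allEdges (a , b) = ∈-cartesianProduct⁺ (∈-allFin a) (∈-allFin b)

  e≤#allEdges : (G : Graph n) → e G ≤ length allEdges
  e≤#allEdges G = length-≤-of-injection (nodup G) id (λ _ _ → id) (λ {x} _ → ∈-allEdges x)

  edgeLists : ℕ → List (List (Edge n))
  edgeLists zero    = [] ∷ []
  edgeLists (suc k) = [] ∷ concatMap (λ x → map (x ∷_) (edgeLists k)) allEdges

  ∈-edgeLists : ∀ k (xs : List (Edge n)) → length xs ≤ k → xs ∈ edgeLists k
  ∈-edgeLists zero    []       _          = here refl
  ∈-edgeLists (suc k) []       _          = here refl
  ∈-edgeLists (suc k) (x ∷ xs) (s≤s len≤) = there (∈-concatMap⁺ (λ x → map (x ∷_) (edgeLists k))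
    (lose (∈-allEdges x) (∈-map⁺ (x ∷_) (∈-edgeLists k xs len≤))))

  ordered? : (xs : List (Edge n)) → Dec (All (λ x → toℕ (proj₁ x) < toℕ (proj₂ x)) xs)
  ordered? = All.all? λ x → toℕ (proj₁ x) <? toℕ (proj₂ x)

  asGraph : List (Edge n) → List (Graph n)
  asGraph xs with ordered? xs | Unique.unique? _≟ᴱ_ xs
  ... | yes xs-ordered | yes xs-unique = record { edges = xs ; ordered = xs-ordered ; nodup = xs-unique } ∷ []
  ... | _              | _             = []

  asGraph-complete : (G : Graph n) → Σ (Graph n) λ G′ → G′ ∈ asGraph (edges G) × edges G′ ≡ edges G
  asGraph-complete G with ordered? (edges G) | Unique.unique? _≟ᴱ_ (edges G)
  ... | yes _       | yes _      = _ , here refl , refl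
  ... | no ¬ordered | _          = contradiction (ordered G) ¬ordered
  ... | yes _       | no ¬unique = contradiction (nodup G) ¬unique

  graphs : List (Graph n)
  graphs = concatMap asGraph (edgeLists (length allEdges))

  graphs-complete : (G : Graph n) → Σ (Graph n) λ G′ → G′ ∈ graphs × edges G′ ≡ edges G
  graphs-complete G with asGraph-complete G
  ... | G′ , G′∈ , G′≡G = G′ , ∈-concatMap⁺ asGraph (lose (∈-edgeLists _ (edges G) (e≤#allEdges G)) G′∈) , G′≡G

  Adjacent : Graph n → Fin n → Fin n → Set
  Adjacent G u w = (u , w) ∈ edges G ⊎ (w , u) ∈ edges G

  module _ (G : Graph n) where

    -- The loop (u , u), which is not an edge of G, stands in for u itself.
    edgeBetween : Fin n → Fin n → Edge n
    edgeBetween u w with u ≟ w | (u , w) ∈? edges G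
    ... | yes _ | _     = (u , u)
    ... | no _  | yes _ = (u , w)
    ... | no _  | no _  = (w , u)

    edgeBetween-links : ∀ u w → Links (edgeBetween u w) u w
    edgeBetween-links u w with u ≟ w | (u , w) ∈? edges G
    ... | yes refl | _     = inj₁ refl
    ... | no _     | yes _ = inj₁ refl
    ... | no _     | no _  = inj₂ refl

    edgeBetween-∈ : ∀ u w → (u ≢ w → Adjacent G u w) → edgeBetween u w ∈ (u , u) ∷ filter (incident? u) (edges G)
    edgeBetween-∈ u w adjacent with u ≟ w | (u , w) ∈? edges G
    ... | yes _  | _       = here refl
    ... | no _   | yes uw∈ = there (∈-filter⁺ (incident? u) uw∈ (inj₁ refl))
    ... | no u≢w | no uw∉ with adjacent u≢w
    ...   | inj₁ uw∈ = contradiction uw∈ uw∉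
    ...   | inj₂ wu∈ = there (∈-filter⁺ (incident? u) wu∈ (inj₂ refl))

    numBelow-clique : ∀ b → (∀ {u w} → degree G u < b → degree G w < b → u ≢ w → Adjacent G u w) → numBelow G b ≤ b
    numBelow-clique b clique = length≤b lights #lights≤1+degree light
      where
      lights : List (Fin n)
      lights = filter (λ v → degree G v <? b) (allFin n)
      light : ∀ {w} → w ∈ lights → degree G w < b
      light w∈ = proj₂ (∈-filter⁻ (λ v → degree G v <? b) {xs = allFin n} w∈)
      #lights≤1+degree : ∀ {u} → u ∈ lights → length lights ≤ suc (degree G u)
      #lights≤1+degree {u} u∈ =
        length-≤-of-injection (filter⁺ (λ v → degree G v <? b) (allFin⁺ n)) (edgeBetween u)
          (λ {w₁} {w₂} _ _ eq → begin
            w₁                         ≡⟨ other-links (edgeBetween-links u w₁) ⟨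
            other u (edgeBetween u w₁) ≡⟨ cong (other u) eq ⟩
            other u (edgeBetween u w₂) ≡⟨ other-links (edgeBetween-links u w₂) ⟩
            w₂                         ∎)
          (λ {w} w∈ → edgeBetween-∈ u w (clique (light u∈) (light w∈)))
        where open ≡-Reasoning
      length≤b : (l : List (Fin n)) → (∀ {u} → u ∈ l → length l ≤ suc (degree G u)) →
                 (∀ {u} → u ∈ l → degree G u < b) → length l ≤ b
      length≤b []      _     _     = z≤n
      length≤b (u ∷ l) bound light = ≤-trans (bound (here refl)) (light (here refl))

-- Deleting and adding edges

module _ (r B : ℕ) {n : ℕ} where

  #proper : List (Edge n) → ℕ
  #proper = properCount r (suc B)

  proper-saturated : ∀ (xs : List (Edge n)) (κ : Vec (Fin r) (length xs)) v → Proper r (suc B) xs κ →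
                     r * B ≤ degreeIn xs v → ∀ c → colourDegree xs κ v c ≡ B
  proper-saturated xs κ v proper r*B≤ =
    ∑-saturated (λ c → s≤s⁻¹ (proper v c)) (subst (r * B ≤_) (sym (∑-colourDegree xs κ v)) r*B≤)

  #proper-removeAt : ∀ (xs : List (Edge n)) p {v} → Incident v (lookup xs p) → r * B ≤ degreeIn xs v →
                     #proper xs ≤ #proper (removeAt xs p)
  #proper-removeAt xs p {v} v∈p r*B≤ =
    properCount-mono r (suc B) xs (removeAt xs p) (removeAtᵛ xs p) restrict-proper restrict-injective
    where
    restrict-proper : ∀ κ → Proper r (suc B) xs κ → Proper r (suc B) (removeAt xs p) (removeAtᵛ xs p κ)
    restrict-proper κ proper w c =
      ≤-<-trans (m≤n+m _ _) (subst (_< suc B) (colourDegree-removeAt xs p κ w c) (proper w c))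
    -- All colours are saturated at v, so the colour of the removed edge is the one that
    -- the restriction leaves one short of B.
    restrict-injective : ∀ {κ₁ κ₂} → Proper r (suc B) xs κ₁ → Proper r (suc B) xs κ₂ →
                         removeAtᵛ xs p κ₁ ≡ removeAtᵛ xs p κ₂ → κ₁ ≡ κ₂
    restrict-injective {κ₁} {κ₂} proper₁ proper₂ eq = removeAtᵛ-injective xs p eq same-colour
      where
      open ≡-Reasoning
      c = Vec.lookup κ₁ p
      R = colourDegree (removeAt xs p) (removeAtᵛ xs p κ₁) v c
      B≡1+R : B ≡ suc R
      B≡1+R = begin
        B                                        ≡⟨ proper-saturated xs κ₁ v proper₁ r*B≤ c ⟨
        colourDegree xs κ₁ v c                   ≡⟨ colourDegree-removeAt xs p κ₁ v c ⟩
        bit (does (colouredAt? xs κ₁ v c p)) + R ≡⟨ cong (λ b → bit b + R) (dec-true (colouredAt? xs κ₁ v c p) (v∈p , refl)) ⟩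
        suc R                                    ∎
      same-colour : c ≡ Vec.lookup κ₂ p
      same-colour with Vec.lookup κ₂ p ≟ c
      ... | yes κ₂p≡c = sym κ₂p≡c
      ... | no  κ₂p≢c = contradiction (trans (sym B≡1+R) B≡R) (1+n≢n {R})
        where
        B≡R : B ≡ R
        B≡R = begin
          B                      ≡⟨ proper-saturated xs κ₂ v proper₂ r*B≤ c ⟨
          colourDegree xs κ₂ v c ≡⟨ colourDegree-removeAt xs p κ₂ v c ⟩
          bit (does (colouredAt? xs κ₂ v c p)) + colourDegree (removeAt xs p) (removeAtᵛ xs p κ₂) v c
            ≡⟨ cong₂ (λ b κ → bit b + colourDegree (removeAt xs p) κ v c)
                     (dec-false (colouredAt? xs κ₂ v c p) (κ₂p≢c ∘ proj₂)) (sym eq) ⟩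
          R                      ∎

  module _ (xs : List (Edge n)) (κ : Vec (Fin r) (length xs)) where

    saturated? : (w : Fin n) → Decidable (λ c → B ≤ colourDegree xs κ w c)
    saturated? w c = B ≤? colourDegree xs κ w c

    B*saturated≤degree : ∀ w → B * count (saturated? w) ≤ degreeIn xs w
    B*saturated≤degree w = begin
      B * count (saturated? w)                     ≡⟨ *-distribˡ-sum B (λ c → bit (does (saturated? w c))) ⟩
      ∑[ c < r ] (B * bit (does (saturated? w c))) ≤⟨ ∑-mono-≤ (λ c → B*bit≤ (saturated? w c)) ⟩
      ∑[ c < r ] colourDegree xs κ w c             ≡⟨ ∑-colourDegree xs κ w ⟩
      degreeIn xs w                                ∎
      where
      open ≤-Reasoning
      B*bit≤ : ∀ {x} (B≤?x : Dec (B ≤ x)) → B * bit (does B≤?x) ≤ x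
      B*bit≤ {x} (yes B≤x) = subst (_≤ x) (sym (*-identityʳ B)) B≤x
      B*bit≤ {x} (no _)    = subst (_≤ x) (sym (*-zeroʳ B)) z≤n

    light⇒few-saturated : ∀ w → degreeIn xs w < ⌈ r /2⌉ * B → count (saturated? w) < ⌈ r /2⌉
    light⇒few-saturated w light = *-cancelʳ-< B _ _
      (≤-<-trans (subst (_≤ degreeIn xs w) (*-comm B _) (B*saturated≤degree w)) light)

    saturated-cover : ∀ a b → (∀ c → ¬ (colourDegree xs κ a c < B × colourDegree xs κ b c < B)) →
                      r ≤ count (saturated? a) + count (saturated? b)
    saturated-cover a b no-free = begin
      r            ≡⟨ *-identityʳ r ⟨
      r * 1        ≡⟨ ∑-const r 1 ⟨
      ∑[ c < r ] 1 ≤⟨ ∑-mono-≤ (λ c → one-saturated (saturated? a c) (saturated? b c) (no-free c)) ⟩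
      ∑[ c < r ] (bit (does (saturated? a c)) + bit (does (saturated? b c)))
                   ≡⟨ ∑-distrib-+ (λ c → bit (does (saturated? a c))) _ ⟩
      count (saturated? a) + count (saturated? b) ∎
      where
      open ≤-Reasoning
      one-saturated : ∀ {x y} (B≤?x : Dec (B ≤ x)) (B≤?y : Dec (B ≤ y)) → ¬ (x < B × y < B) →
                      1 ≤ bit (does B≤?x) + bit (does B≤?y)
      one-saturated (yes _)  _        _     = s≤s z≤n
      one-saturated (no _)   (yes _)  _     = s≤s z≤n
      one-saturated (no B≰x) (no B≰y) ¬both = contradiction (≰⇒> B≰x , ≰⇒> B≰y) ¬both

    free-colour : ∀ a b → degreeIn xs a < ⌈ r /2⌉ * B → degreeIn xs b < ⌈ r /2⌉ * B →
                  Σ (Fin r) λ c → colourDegree xs κ a c < B × colourDegree xs κ b c < B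
    free-colour a b light-a light-b
      with Fin.any? (λ c → (colourDegree xs κ a c <? B) ×-dec (colourDegree xs κ b c <? B))
    ... | yes free = free
    ... | no ¬free = contradiction (saturated-cover a b (λ c free-c → ¬free (c , free-c))) (<⇒≱ few-saturated)
      where
      sa = count (saturated? a)
      sb = count (saturated? b)
      few-saturated : sa + sb < r
      few-saturated = s≤s⁻¹ (begin
        suc (suc (sa + sb)) ≡⟨ cong suc (+-suc sa sb) ⟨
        suc sa + suc sb     ≤⟨ +-mono-≤ (light⇒few-saturated a light-a) (light⇒few-saturated b light-b) ⟩
        ⌈ r /2⌉ + ⌈ r /2⌉   ≤⟨ ⌈n/2⌉+⌈n/2⌉≤1+n r ⟩
        suc r               ∎)
        where open ≤-Reasoning

  #proper-∷ : ∀ (xs : List (Edge n)) a b → degreeIn xs a < ⌈ r /2⌉ * B → degreeIn xs b < ⌈ r /2⌉ * B →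
              #proper xs ≤ #proper ((a , b) ∷ xs)
  #proper-∷ xs a b light-a light-b =
    properCount-mono r (suc B) xs ((a , b) ∷ xs) extend extend-proper (λ _ _ → proj₂ ∘ Vec.∷-injective)
    where
    free : ∀ κ → Σ (Fin r) λ c → colourDegree xs κ a c < B × colourDegree xs κ b c < B
    free κ = free-colour xs κ a b light-a light-b
    extend : Vec (Fin r) (length xs) → Vec (Fin r) (length ((a , b) ∷ xs))
    extend κ = proj₁ (free κ) ∷ κ
    extend-proper : ∀ κ → Proper r (suc B) xs κ → Proper r (suc B) ((a , b) ∷ xs) (extend κ)
    extend-proper κ proper w c = new-edge (incident? w (a , b) ×-dec (proj₁ (free κ) ≟ c)) (proper w c)
      where
      new-edge : ∀ (new? : Dec (Incident w (a , b) × proj₁ (free κ) ≡ c)) → colourDegree xs κ w c < suc B →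
                 bit (does new?) + colourDegree xs κ w c < suc B
      new-edge (no _)                   old = old
      new-edge (yes (inj₁ refl , refl)) _   = s≤s (proj₁ (proj₂ (free κ)))
      new-edge (yes (inj₂ refl , refl)) _   = s≤s (proj₂ (proj₂ (free κ)))

-- The extremal graph

  module _ (light<heavy : ⌈ r /2⌉ * B < r * B) where

    BoundedDegree : List (Edge n) → Set
    BoundedDegree xs = ∀ v → degreeIn xs v < r * B

    boundedDegree? : Decidable BoundedDegree
    boundedDegree? xs = Fin.all? λ v → degreeIn xs v <? r * B

    heavyEdge : ∀ xs → ¬ BoundedDegree xs →
                Σ (Fin n) λ v → Σ (Fin (length xs)) λ p → Incident v (lookup xs p) × r * B ≤ degreeIn xs v
    heavyEdge xs unbounded = v , proj₁ incidentEdge zero , proj₂ (proj₂ incidentEdge) zero , heavy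
      where
      counterexample = Fin.¬∀⟶∃¬ n _ (λ v → degreeIn xs v <? r * B) unbounded
      v = proj₁ counterexample
      heavy : r * B ≤ degreeIn xs v
      heavy = ≮⇒≥ (proj₂ counterexample)
      incidentEdge = ≤count⇒injection (incident? v ∘ lookup xs) (≤-trans (≤-<-trans z≤n light<heavy) heavy)

    removeEdge : (G : Graph n) → Fin (e G) → Graph n
    removeEdge G p = record
      { edges = removeAt (edges G) p ; ordered = All-removeAt p (ordered G) ; nodup = Unique-removeAt p (nodup G) }

    BoundedImprovement : Graph n → Set
    BoundedImprovement G = Σ (Graph n) λ G′ → BoundedDegree (edges G′) × #proper (edges G) ≤ #proper (edges G′)

    boundedImprovement : (G : Graph n) → BoundedImprovement G
    boundedImprovement G = go (e G) G refl
      where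
      go : ∀ k (G : Graph n) → e G ≡ k → BoundedImprovement G
      go k G eG with boundedDegree? (edges G)
      ... | yes bounded = G , bounded , ≤-refl
      ... | no unbounded with heavyEdge (edges G) unbounded | k
      ...   | _ , p , _   , _     | zero   = contradiction (subst Fin eG p) Fin.¬Fin0
      ...   | _ , p , v∈p , heavy | suc k′
            with go k′ (removeEdge G p) (suc-injective (trans (sym (length-removeAt′ (edges G) p)) eG))
      ...     | G′ , bounded , ≤G′ = G′ , bounded , ≤-trans (#proper-removeAt (edges G) p v∈p heavy) ≤G′

    N : ℕ
    N = length (allEdges {n})

    bonus : List (Edge n) → ℕ
    bonus xs with boundedDegree? xs
    ... | yes _ = suc (length xs)
    ... | no _  = 0

    bonus≤1+N : ∀ G → bonus (edges G) ≤ suc N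
    bonus≤1+N G with boundedDegree? (edges G)
    ... | yes _ = s≤s (e≤#allEdges G)
    ... | no _  = z≤n

    bonus-<-bounded : ∀ {xs ys} → ¬ BoundedDegree xs → BoundedDegree ys → bonus xs < bonus ys
    bonus-<-bounded {xs} {ys} ¬bounded-xs bounded-ys with boundedDegree? xs | boundedDegree? ys
    ... | yes bounded-xs | _              = contradiction bounded-xs ¬bounded-xs
    ... | no _           | yes _          = s≤s z≤n
    ... | no _           | no ¬bounded-ys = contradiction bounded-ys ¬bounded-ys

    bonus-<-∷ : ∀ {x xs} → BoundedDegree xs → BoundedDegree (x ∷ xs) → bonus xs < bonus (x ∷ xs)
    bonus-<-∷ {x} {xs} bounded bounded′ with boundedDegree? xs | boundedDegree? (x ∷ xs)
    ... | yes _       | yes _        = n<1+n _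
    ... | no ¬bounded | _            = contradiction bounded ¬bounded
    ... | yes _       | no ¬bounded′ = contradiction bounded′ ¬bounded′

    -- Since bonus ≤ N + 1, weights compare #proper first and bonus second.
    weight : List (Edge n) → ℕ
    weight xs = #proper xs * suc (suc N) + bonus xs

    emptyGraph : Graph n
    emptyGraph = record { edges = [] ; ordered = [] ; nodup = [] }

    opaque
      extremalGraph : Graph n
      extremalGraph = argmax (weight ∘ edges) emptyGraph graphs

      weight-maximal : ∀ G → weight (edges G) ≤ weight (edges extremalGraph)
      weight-maximal G =
        subst (λ xs → weight xs ≤ weight (edges extremalGraph)) (proj₂ (proj₂ (graphs-complete G)))
          (All.lookup (f[xs]≤f[argmax] {f = weight ∘ edges} emptyGraph graphs) (proj₁ (proj₂ (graphs-complete G))))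

    #proper-maximal : ∀ G → #proper (edges G) ≤ #proper (edges extremalGraph)
    #proper-maximal G = ≮⇒≥ λ fewer →
      <⇒≱ (*+-<-leading (bonus (edges G)) (s≤s (bonus≤1+N extremalGraph)) fewer) (weight-maximal G)

    extremalGraph-bounded : BoundedDegree (edges extremalGraph)
    extremalGraph-bounded = decidable-stable (boundedDegree? (edges extremalGraph)) λ unbounded →
      let (G′ , bounded′ , ≤G′) = boundedImprovement extremalGraph in
      <⇒≱ (*+-<-trailing (suc (suc N)) ≤G′ (bonus-<-bounded unbounded bounded′)) (weight-maximal G′)

    extremalGraph-light-edge : ∀ {a b} → toℕ a < toℕ b → degreeIn (edges extremalGraph) a < ⌈ r /2⌉ * B →
                               degreeIn (edges extremalGraph) b < ⌈ r /2⌉ * B → (a , b) ∈ edges extremalGraph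
    extremalGraph-light-edge {a} {b} a<b light-a light-b = decidable-stable ((a , b) ∈? xs) λ ab∉ →
      <⇒≱ (*+-<-trailing (suc (suc N)) (#proper-∷ xs a b light-a light-b) (bonus-<-∷ extremalGraph-bounded bounded+))
          (weight-maximal (record { edges = (a , b) ∷ xs ; ordered = a<b ∷ ordered extremalGraph
                                  ; nodup = ¬Any⇒All¬ xs ab∉ ∷ nodup extremalGraph }))
      where
      xs = edges extremalGraph
      bounded+ : BoundedDegree ((a , b) ∷ xs)
      bounded+ v = new-edge (incident? v (a , b))
        where
        new-edge : (v∈? : Dec (Incident v (a , b))) → bit (does v∈?) + degreeIn xs v < r * B
        new-edge (no _)            = extremalGraph-bounded v
        new-edge (yes (inj₁ refl)) = ≤-trans (s≤s light-a) light<heavy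
        new-edge (yes (inj₂ refl)) = ≤-trans (s≤s light-b) light<heavy

    extremalGraph-light-clique : ∀ {u w} → degree extremalGraph u < ⌈ r /2⌉ * B →
                                 degree extremalGraph w < ⌈ r /2⌉ * B → u ≢ w → Adjacent extremalGraph u w
    extremalGraph-light-clique {u} {w} light-u light-w u≢w = adjacent (<-cmp (toℕ u) (toℕ w))
      where
      light-u′ = subst (_< ⌈ r /2⌉ * B) (degree≡degreeIn extremalGraph u) light-u
      light-w′ = subst (_< ⌈ r /2⌉ * B) (degree≡degreeIn extremalGraph w) light-w
      adjacent : Tri (toℕ u < toℕ w) (toℕ u ≡ toℕ w) (toℕ w < toℕ u) → Adjacent extremalGraph u w
      adjacent (tri< u<w _ _) = inj₁ (extremalGraph-light-edge u<w light-u′ light-w′)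
      adjacent (tri≈ _ u≡w _) = contradiction (Fin.toℕ-injective u≡w) u≢w
      adjacent (tri> _ _ w<u) = inj₂ (extremalGraph-light-edge w<u light-w′ light-u′)

    extremalGraph-extremal : Extremal r (suc B) extremalGraph
    extremalGraph-extremal = #proper (edges extremalGraph) , numGood-properCount r (suc B) extremalGraph ,
      λ G _ numGood → ≤-trans (numGood⇒≤properCount r (suc B) G numGood) (#proper-maximal G)

    extremalGraph-maxDegree : ∀ v → degree extremalGraph v ≤ r * B ∸ 1
    extremalGraph-maxDegree v =
      <⇒≤pred (subst (_< r * B) (sym (degree≡degreeIn extremalGraph v)) (extremalGraph-bounded v))

    extremalGraph-numBelow : numBelow extremalGraph (⌈ r /2⌉ * B) ≤ ⌈ r /2⌉ * B
    extremalGraph-numBelow = numBelow-clique extremalGraph (⌈ r /2⌉ * B) extremalGraph-light-clique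

lemma1 : (r t : ℕ) → 2 ≤ r → 3 ≤ t →
    Σ ℕ λ c → c ≤ r * t + 1 ×
      ((n : ℕ) → 1 ≤ n →
        Σ (Graph n) λ G → Extremal r t G
          × ((v : Fin n) → degree G v ≤ r * (t ∸ 1) ∸ 1)
          × numBelow G (⌈ r /2⌉ * (t ∸ 1)) ≤ c)
lemma1 r zero    _   ()
lemma1 r (suc B) 2≤r (s≤s 2≤B) =
  ⌈ r /2⌉ * B , ≤-trans (*-mono-≤ (⌈n/2⌉≤n r) (n≤1+n B)) (m≤m+n (r * suc B) 1) ,
  λ n _ → extremalGraph r B {n} light<heavy ,
          extremalGraph-extremal r B light<heavy ,
          extremalGraph-maxDegree r B light<heavy ,
          extremalGraph-numBelow r B {n} light<heavy
  where
  ⌈m/2⌉<m : ∀ {m} → 2 ≤ m → ⌈ m /2⌉ < m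
  ⌈m/2⌉<m (s≤s (s≤s _)) = ⌈n/2⌉<n _
  light<heavy : ⌈ r /2⌉ * B < r * B
  light<heavy = *-monoˡ-< B {{>-nonZero (<⇒≤ 2≤B)}} (⌈m/2⌉<m 2≤r)
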